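{- For a graph $G$ the following are equivalent: (a) $G=\mathcal{C}\langle M\rangle$ for some quasigroup $M$; (b) $G=\mathcal{C}\langle M\rangle$ for some quasigroup $M$ with a left identity; (c) $G$ is simple, deterministic, co-deterministic, complete, source-complete and target-complete. Likewise, the following are equivalent: (a') $G=\mathcal{C}\langle M\rangle$ for some quasigroup $M$ with a right identity; (b') $G=\mathcal{C}\langle M\rangle$ for some quasigroup $M$ with an identity; (c') $G$ is simple, deterministic, co-deterministic, complete, source-complete, target-complete and loop-complete.
   Context: A graph is a non-empty set $G\subseteq V\times A\times V$ of labeled edges $s\xrightarrow{a}_G t$; $V_G$ is the set of vertices occurring in edges, $A_G$ the set of labels. For a magma $(M,\cdot)$ and an injective map $\langle\,\rangle:M\to A$, $\mathcal{C}\langle M\rangle=\{(p,\langle q\rangle,p\cdot q): p,q\in M\}$ (any such injective labeling allowed). A magma is a quasigroup if for all $p,q$ there is a unique $r$ with $p\cdot r=q$ and a unique $s$ with $s\cdot p=q$. Left identity: $e\cdot p=p$ for all $p$; right identity: $p\cdot e=p$ for all $p$; identity: both. $G$ is simple if no two edges share source and target; deterministic if $r\xrightarrow{a}s$, $r\xrightarrow{a}t$ imply $s=t$; co-deterministic if $s\xrightarrow{a}r$, $t\xrightarrow{a}r$ imply $s=t$; complete if for all $s,t\in V_G$ there is an edge from $s$ to $t$; source-complete if for all $s\in V_G$, $a\in A_G$ there is $t$ with $s\xrightarrow{a}_G t$; target-complete if for all $t\in V_G$, $a\in A_G$ there is $s$ with $s\xrightarrow{a}_G t$; loop-complete if whenever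 some vertex has an $a$-labeled loop, every vertex has an $a$-labeled loop. -}

module Defs where

open import Level using (Level; _⊔_) renaming (suc to lsuc; zero to lzero)
open import Data.Product using (Σ; ∃; ∃-syntax; _×_; _,_)
open import Relation.Binary.PropositionalEquality using (_≡_)
open import Data.Sum using (_⊎_)
open import Function.Bundles using (_⇔_)
open import Function.Definitions using (Injective)

-- A graph over vertex universe V and label universe A: a non-empty SET of
-- triples (s , a , t), given as a proposition-valued membership predicate.
record Graph (V A : Set) : Set₁ where
  field
    Edge      : V → A → V → Set
    Edge-prop : ∀ {s a t} (x y : Edge s a t) → x ≡ y
    nonempty  : ∃[ s ] ∃[ a ] ∃[ t ] Edge s a t

module _ {V A : Set} (G : Graph V A) where
  open Graph G

  IsVertex : V → Set
  IsVertex v = (∃[ a ] ∃[ t ] Edge v a t) ⊎ (∃[ s ] ∃[ a ] Edge s a v)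
  IsLabel : A → Set
  IsLabel a = ∃[ s ] ∃[ t ] Edge s a t

  Simple : Set
  Simple = ∀ {s t a b} → Edge s a t → Edge s b t → a ≡ b

  Deterministic : Set
  Deterministic = ∀ {r s t a} → Edge r a s → Edge r a t → s ≡ t

  CoDeterministic : Set
  CoDeterministic = ∀ {r s t a} → Edge s a r → Edge t a r → s ≡ t

  Complete : Set
  Complete = ∀ {s t} → IsVertex s → IsVertex t → ∃[ a ] Edge s a t

  SourceComplete : Set
  SourceComplete = ∀ {s a} → IsVertex s → IsLabel a → ∃[ t ] Edge s a t

  TargetComplete : Set
  TargetComplete = ∀ {t a} → IsVertex t → IsLabel a → ∃[ s ] Edge s a t

  LoopComplete : Set
  LoopComplete = ∀ {a} → (∃[ v ] Edge v a v) → ∀ {u} → IsVertex u → Edge u a u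

-- A magma whose elements are vertices: a subset of V (carrier M together with
-- an injective inclusion into V) with a binary operation.
record VMagma (V : Set) : Set₁ where
  field
    Carrier : Set
    incl    : Carrier → V
    incl-injective : Injective _≡_ _≡_ incl
    _·_     : Carrier → Carrier → Carrier

module _ {V : Set} (M : VMagma V) where
  open VMagma M

  ∃!≡ : {X : Set} → (X → Set) → Set
  ∃!≡ {X} P = Σ X (λ x → P x × (∀ y → P y → x ≡ y))

  IsQuasigroup : Set
  IsQuasigroup = ∀ p q → ∃!≡ (λ r → p · r ≡ q) × ∃!≡ (λ s → s · p ≡ q)

  IsLeftIdentity : Carrier → Set
  IsLeftIdentity e = ∀ p → e · p ≡ p

  IsRightIdentity : Carrier → Set
  IsRightIdentity e = ∀ p → p · e ≡ p

  HasLeftIdentity : Set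
  HasLeftIdentity = ∃[ e ] IsLeftIdentity e

  HasRightIdentity : Set
  HasRightIdentity = ∃[ e ] IsRightIdentity e

  HasIdentity : Set
  HasIdentity = ∃[ e ] (IsLeftIdentity e × IsRightIdentity e)

  IsCayleyOf : {A : Set} → (lab : Carrier → A) → Graph V A → Set
  IsCayleyOf lab G = ∀ s a t →
    (Graph.Edge G s a t ⇔ (∃[ p ] ∃[ q ] (s ≡ incl p × a ≡ lab q × t ≡ incl (p · q))))

CayleyWith : {V A : Set} → (Prop : VMagma V → Set) → Graph V A → Set₁
CayleyWith {V} {A} Prop G =
  Σ (VMagma V) λ M → Prop M ×
    Σ (VMagma.Carrier M → A) λ lab → Injective _≡_ _≡_ lab × IsCayleyOf M lab G

QG : ∀ {V} → VMagma V → Set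
QG M = IsQuasigroup M

QGLeftId : ∀ {V} → VMagma V → Set
QGLeftId M = IsQuasigroup M × HasLeftIdentity M

QGRightId : ∀ {V} → VMagma V → Set
QGRightId M = IsQuasigroup M × HasRightIdentity M

QGId : ∀ {V} → VMagma V → Set
QGId M = IsQuasigroup M × HasIdentity M

CondC : {V A : Set} → Graph V A → Set
CondC G = Simple G × Deterministic G × CoDeterministic G × Complete G
          × SourceComplete G × TargetComplete G

CondC' : {V A : Set} → Graph V A → Set
CondC' G = CondC G × LoopComplete G

-- A Cayley graph of a quasigroup inherits (c) directly: labels and sources determine
-- targets because the product is a function, and unique left/right division gives
-- simplicity, co-determinism and the three completeness properties; a right identity e
-- makes ⟨e⟩ the loop label at every vertex. Conversely, given (c), fix a base vertex b.
-- Completeness and simplicity give every vertex v a unique label ⟨v⟩ of an edge b → v,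
-- and p · q is the ⟨q⟩-successor of p. The base is a left identity because b → q
-- carries ⟨q⟩; determinism, simplicity and co-determinism turn the completeness
-- properties into unique division; under loop completeness the loop label ⟨b⟩ of b
-- sits on every vertex, so b is also a right identity.
module Submission where

open import Defs
open import Data.Product using (_×_; ∃-syntax; _,_; proj₁; proj₂)
open import Data.Sum using (inj₁; inj₂)
open import Function.Base using (_∘_)
open import Function.Bundles using (_⇔_; mk⇔; Equivalence)
open import Function.Definitions using (Injective)
open import Relation.Binary.PropositionalEquality using (_≡_; refl; sym; trans; cong; cong₂)

module _ {V : Set} (M : VMagma V) (isQuasigroup : IsQuasigroup M) where
  open VMagma M

  left-divisible : ∀ p q → ∃[ r ] p · r ≡ q
  left-divisible p q = let (r , pr≡q , _) = proj₁ (isQuasigroup p q) in r , pr≡q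

  right-divisible : ∀ p q → ∃[ s ] s · p ≡ q
  right-divisible p q = let (s , sp≡q , _) = proj₂ (isQuasigroup p q) in s , sp≡q

  ·-cancelˡ : ∀ p {q r} → p · q ≡ p · r → q ≡ r
  ·-cancelˡ p {q} {r} pq≡pr =
    let (_ , _ , unique) = proj₁ (isQuasigroup p (p · q))
    in trans (sym (unique q refl)) (unique r (sym pq≡pr))

  ·-cancelʳ : ∀ p {q r} → q · p ≡ r · p → q ≡ r
  ·-cancelʳ p {q} {r} qp≡rp =
    let (_ , _ , unique) = proj₂ (isQuasigroup p (q · p))
    in trans (sym (unique q refl)) (unique r (sym qp≡rp))

CayleyWith-mono : {V A : Set} {P Q : VMagma V → Set} → (∀ M → P M → Q M) →
                  (G : Graph V A) → CayleyWith P G → CayleyWith Q G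
CayleyWith-mono P⇒Q G (M , PM , cayley) = M , P⇒Q M PM , cayley

module CayleyGraph {V A : Set} (G : Graph V A) (M : VMagma V)
  (lab : VMagma.Carrier M → A) (lab-injective : Injective _≡_ _≡_ lab)
  (isCayley : IsCayleyOf M lab G) where
  open Graph G
  open VMagma M

  edge : ∀ {p q r} → p · q ≡ r → Edge (incl p) (lab q) (incl r)
  edge {p} {q} {r} pq≡r = Equivalence.from (isCayley (incl p) (lab q) (incl r))
    (p , q , refl , refl , cong incl (sym pq≡r))

  edge⁻¹ : ∀ {s a t} → Edge s a t →
           ∃[ p ] ∃[ q ] (s ≡ incl p × a ≡ lab q × t ≡ incl (p · q))
  edge⁻¹ {s} {a} {t} = Equivalence.to (isCayley s a t)

  edge-target : ∀ {p q t} → Edge (incl p) (lab q) t → t ≡ incl (p · q)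
  edge-target e with edge⁻¹ e
  ... | p′ , q′ , p≡p′ , q≡q′ , refl =
    cong incl (cong₂ _·_ (sym (incl-injective p≡p′)) (sym (lab-injective q≡q′)))

  vertex-incl : ∀ {v} → IsVertex G v → ∃[ p ] v ≡ incl p
  vertex-incl (inj₁ (_ , _ , e)) with edge⁻¹ e
  ... | p , _ , refl , _ , _ = p , refl
  vertex-incl (inj₂ (_ , _ , e)) with edge⁻¹ e
  ... | p , q , _ , _ , refl = p · q , refl

  label-lab : ∀ {a} → IsLabel G a → ∃[ q ] a ≡ lab q
  label-lab (_ , _ , e) with edge⁻¹ e
  ... | _ , q , _ , refl , _ = q , refl

  simple : IsQuasigroup M → Simple G
  simple qg e₁ e₂ with edge⁻¹ e₁ | label-lab (_ , _ , e₂)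
  ... | p , q , refl , refl , refl | q′ , refl =
    cong lab (·-cancelˡ M qg p (incl-injective (edge-target e₂)))

  deterministic : Deterministic G
  deterministic e₁ e₂ with edge⁻¹ e₁
  ... | _ , _ , refl , refl , refl = sym (edge-target e₂)

  coDeterministic : IsQuasigroup M → CoDeterministic G
  coDeterministic qg e₁ e₂ with edge⁻¹ e₁ | vertex-incl (inj₁ (_ , _ , e₂))
  ... | p , q , refl , refl , refl | p′ , refl =
    cong incl (·-cancelʳ M qg q (incl-injective (edge-target e₂)))

  complete : IsQuasigroup M → Complete G
  complete qg vs vt with vertex-incl vs | vertex-incl vt
  ... | p , refl | q , refl = let (r , pr≡q) = left-divisible M qg p q in lab r , edge pr≡q

  sourceComplete : SourceComplete G
  sourceComplete vs la with vertex-incl vs | label-lab la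
  ... | p , refl | q , refl = incl (p · q) , edge refl

  targetComplete : IsQuasigroup M → TargetComplete G
  targetComplete qg vt la with vertex-incl vt | label-lab la
  ... | p , refl | q , refl = let (s , sq≡p) = right-divisible M qg q p in incl s , edge sq≡p

  loopComplete : IsQuasigroup M → HasRightIdentity M → LoopComplete G
  loopComplete qg (e , p·e≡p) (_ , loop) vu with edge⁻¹ loop | vertex-incl vu
  ... | p , q , refl , refl , pq≡p | p′ , refl =
    let q≡e = ·-cancelˡ M qg p (trans (sym (incl-injective pq≡p)) (sym (p·e≡p p)))
    in edge (trans (cong (p′ ·_) q≡e) (p·e≡p p′))

  condC : IsQuasigroup M → CondC G
  condC qg = simple qg , deterministic , coDeterministic qg , complete qg
           , sourceComplete , targetComplete qg

cayleyQG⇒condC : {V A : Set} (G : Graph V A) → CayleyWith QG G → CondC G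
cayleyQG⇒condC G (M , qg , lab , lab-injective , isCayley) =
  CayleyGraph.condC G M lab lab-injective isCayley qg

cayleyQGRightId⇒condC' : {V A : Set} (G : Graph V A) → CayleyWith QGRightId G → CondC' G
cayleyQGRightId⇒condC' G (M , (qg , rightId) , lab , lab-injective , isCayley) =
  condC qg , loopComplete qg rightId
  where open CayleyGraph G M lab lab-injective isCayley

module FromCondC {V A : Set} (G : Graph V A) (simple : Simple G)
  (deterministic : Deterministic G) (coDeterministic : CoDeterministic G)
  (complete : Complete G) (sourceComplete : SourceComplete G)
  (targetComplete : TargetComplete G) where
  open Graph G

  base : V
  base = proj₁ nonempty

  base-vertex : IsVertex G base
  base-vertex = inj₁ (proj₂ nonempty)

  -- By completeness and simplicity, this is V_G with each vertex v paired with ⟨v⟩.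
  Element : Set
  Element = ∃[ v ] ∃[ a ] Edge base a v

  vertex : Element → V
  vertex = proj₁

  label : Element → A
  label = proj₁ ∘ proj₂

  element : ∀ {v} → IsVertex G v → Element
  element {v} iv = v , complete base-vertex iv

  element-labelled : ∀ {a} → IsLabel G a → Element
  element-labelled {a} la = let (v , e) = sourceComplete base-vertex la in v , a , e

  vertex-isVertex : ∀ x → IsVertex G (vertex x)
  vertex-isVertex (_ , a , e) = inj₂ (base , a , e)

  label-isLabel : ∀ x → IsLabel G (label x)
  label-isLabel (v , _ , e) = base , v , e

  vertex-injective : Injective _≡_ _≡_ vertex
  vertex-injective {v , a , e} {.v , b , e′} refl with simple e e′
  ... | refl = cong (λ e″ → v , a , e″) (Edge-prop e e′)

  label-injective : Injective _≡_ _≡_ label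
  label-injective {_ , a , e} {_ , .a , e′} refl = vertex-injective (deterministic e e′)

  successor : ∀ p q → ∃[ t ] Edge (vertex p) (label q) t
  successor p q = sourceComplete (vertex-isVertex p) (label-isLabel q)

  _∙_ : Element → Element → Element
  p ∙ q = element (inj₂ (vertex p , label q , proj₂ (successor p q)))

  ∙-edge : ∀ {p q r} → p ∙ q ≡ r → Edge (vertex p) (label q) (vertex r)
  ∙-edge {p} {q} refl = proj₂ (successor p q)

  ∙-unique : ∀ {p q r} → Edge (vertex p) (label q) (vertex r) → p ∙ q ≡ r
  ∙-unique e = vertex-injective (deterministic (∙-edge refl) e)

  magma : VMagma V
  magma = record { Carrier = Element ; incl = vertex
                 ; incl-injective = vertex-injective ; _·_ = _∙_ }

  ε : Element
  ε = element base-vertex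

  ε-identityˡ : IsLeftIdentity magma ε
  ε-identityˡ (_ , _ , e) = ∙-unique e

  ε-identityʳ : LoopComplete G → IsRightIdentity magma ε
  ε-identityʳ loopComplete p =
    ∙-unique (loopComplete (base , proj₂ (complete base-vertex base-vertex)) (vertex-isVertex p))

  left-division : ∀ p q → ∃!≡ magma (λ r → p ∙ r ≡ q)
  left-division p q =
    let (_ , e) = complete (vertex-isVertex p) (vertex-isVertex q)
    in element-labelled (_ , _ , e) , ∙-unique e ,
       λ r pr≡q → label-injective (simple e (∙-edge pr≡q))

  right-division : ∀ p q → ∃!≡ magma (λ s → s ∙ p ≡ q)
  right-division p q =
    let (_ , e) = targetComplete (vertex-isVertex q) (label-isLabel p)
    in element (inj₁ (_ , _ , e)) , ∙-unique e ,
       λ s sp≡q → vertex-injective (coDeterministic e (∙-edge sp≡q))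

  isQuasigroup : IsQuasigroup magma
  isQuasigroup p q = left-division p q , right-division p q

  isCayley : IsCayleyOf magma label G
  isCayley s a t = mk⇔ to from
    where
    to : Edge s a t → ∃[ p ] ∃[ q ] (s ≡ vertex p × a ≡ label q × t ≡ vertex (p ∙ q))
    to e = element (inj₁ (a , t , e)) , element-labelled (s , t , e) , refl , refl
         , deterministic e (∙-edge refl)
    from : (∃[ p ] ∃[ q ] (s ≡ vertex p × a ≡ label q × t ≡ vertex (p ∙ q))) → Edge s a t
    from (_ , _ , refl , refl , refl) = ∙-edge refl

condC⇒cayleyQGLeftId : {V A : Set} (G : Graph V A) → CondC G → CayleyWith QGLeftId G
condC⇒cayleyQGLeftId G (simple , det , codet , complete , sourceComplete , targetComplete) =
  magma , (isQuasigroup , ε , ε-identityˡ) , label , label-injective , isCayley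
  where open FromCondC G simple det codet complete sourceComplete targetComplete

condC'⇒cayleyQGId : {V A : Set} (G : Graph V A) → CondC' G → CayleyWith QGId G
condC'⇒cayleyQGId G ((simple , det , codet , complete , sourceComplete , targetComplete) , loop) =
  magma , (isQuasigroup , ε , ε-identityˡ , ε-identityʳ loop) , label , label-injective , isCayley
  where open FromCondC G simple det codet complete sourceComplete targetComplete

proposition7p2 : {V A : Set} (G : Graph V A) →
    ((CayleyWith QG G ⇔ CayleyWith QGLeftId G) × (CayleyWith QGLeftId G ⇔ CondC G))
    × ((CayleyWith QGRightId G ⇔ CayleyWith QGId G) × (CayleyWith QGId G ⇔ CondC' G))
proposition7p2 G =
  ( mk⇔ (condC⇒cayleyQGLeftId G ∘ cayleyQG⇒condC G) forgetLeftId
  , mk⇔ (cayleyQG⇒condC G ∘ forgetLeftId) (condC⇒cayleyQGLeftId G) )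
  , ( mk⇔ (condC'⇒cayleyQGId G ∘ cayleyQGRightId⇒condC' G) forgetLeftId'
    , mk⇔ (cayleyQGRightId⇒condC' G ∘ forgetLeftId') (condC'⇒cayleyQGId G) )
  where
  forgetLeftId : CayleyWith QGLeftId G → CayleyWith QG G
  forgetLeftId = CayleyWith-mono (λ _ → proj₁) G
  forgetLeftId' : CayleyWith QGId G → CayleyWith QGRightId G
  forgetLeftId' = CayleyWith-mono (λ { _ (qg , e , _ , p·e≡p) → qg , e , p·e≡p }) G
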